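{- Let $p$ be a prime, $d\ge1$, $\epsilon\in\{0,1\}^{d-1}$ fixed, and $\mathbf{a}=(a_1,\ldots,a_d),\mathbf{b}=(b_1,\ldots,b_d)\in\mathbb{Z}_p^d$. (1) $\mathcal{P}^{\mathbf{a},\epsilon}_{d,p}=\mathcal{P}^{\mathbf{b},\epsilon}_{d,p}$ if and only if there exists $c\in\{1,\ldots,p-1\}$ such that $b_jc^j\equiv a_j \pmod p$ for $j=1,\ldots,d$. (2) If $\mathcal{P}^{\mathbf{a},\epsilon}_{d,p}\ne\mathcal{P}^{\mathbf{b},\epsilon}_{d,p}$, then $\mathcal{P}^{\mathbf{a},\epsilon}_{d,p}\cap\mathcal{P}^{\mathbf{b},\epsilon}_{d,p}=\{(0,\ldots,0)\}$.
   Context: For a real $x\ge0$, $\{x\}$ denotes its fractional part; $\mathbb{Z}_p=\{0,1,\ldots,p-1\}$ and $\mathbb{Z}_p^d$ is the set of integer vectors with entries in $\mathbb{Z}_p$. For a prime $p$, $\mathbf{a}=(a_1,\ldots,a_d)\in\mathbb{Z}_p^d$ and $\epsilon\in\{0,1\}^{d-1}$, put $a_h'=\epsilon_h a_h$ ($1\le h\le d-1$) and for $j\in\mathbb{Z}_p$ let $\mathbf{x}^{\mathbf{a},\epsilon}_j\in[0,1)^d$ be the point whose $i$-th coordinate ($1\le i\le d$) is $\{(\sum_{h=1}^{i-1}a_h'j^h+a_ij^i)/p\}$ (so the first coordinate is $\{a_1j/p\}$). Set $\mathcal{P}^{\mathbf{a},\epsilon}_{d,p}=\{\mathbf{x}^{\mathbf{a},\epsilon}_j: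 j\in\mathbb{Z}_p\}$. -}

module Defs where

open import Data.Nat using (ℕ; zero; suc; _+_; _*_; _^_; _<_; _<ᵇ_)
open import Data.Nat.DivMod using (_%_)
open import Data.Nat.Primality using (Prime; prime⇒nonZero)
open import Data.Bool using (Bool; if_then_else_)
open import Data.Fin using (Fin; toℕ; inject₁)
open import Data.Vec using (Vec; tabulate; sum)
open import Data.Product using (∃-syntax; _×_)
open import Relation.Binary.PropositionalEquality using (_≡_)

modP : (p : ℕ) → Prime p → ℕ → ℕ
modP p pr m = _%_ m p {{prime⇒nonZero pr}}

-- A point of [0,1)^d whose coordinates are of the form {m/p} is represented by
-- the vector of numerators (m mod p) ∈ ℤ_p; the map k ↦ k/p is injective on ℤ_p.
-- Dimension d = suc n; 0-based index k : Fin (suc n) stands for coordinate k+1.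
-- ε : Fin n → Bool stands for (ε_1,…,ε_{d-1}); a : Fin (suc n) → ℕ for (a_1,…,a_d).

a′ : ∀ {n} → (Fin n → Bool) → (Fin (suc n) → ℕ) → Fin n → ℕ
a′ ε a h = if ε h then a (inject₁ h) else 0

-- numerator of the i-th coordinate of x_j^{a,ε}:
-- (Σ_{h=1}^{i-1} a'_h j^h + a_i j^i) mod p
coord : (p : ℕ) → Prime p → ∀ {n} → (Fin n → Bool) → (Fin (suc n) → ℕ)
      → ℕ → Fin (suc n) → ℕ
coord p pr {n} ε a j k =
  modP p pr (sum (tabulate {n} (λ h → if toℕ h <ᵇ toℕ k
                                        then a′ ε a h * j ^ suc (toℕ h)
                                        else 0))
             + a k * j ^ suc (toℕ k))

point : (p : ℕ) → Prime p → ∀ {n} → (Fin n → Bool) → (Fin (suc n) → ℕ)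
      → ℕ → Vec ℕ (suc n)
point p pr ε a j = tabulate (coord p pr ε a j)

_∈P[_,_,_,_] : ∀ {n} → Vec ℕ (suc n) → (p : ℕ) → Prime p
             → (Fin n → Bool) → (Fin (suc n) → ℕ) → Set
x ∈P[ p , pr , ε , a ] = ∃[ j ] (j < p × x ≡ point p pr ε a j)

SameSet : (p : ℕ) → Prime p → ∀ {n} → (Fin n → Bool)
        → (Fin (suc n) → ℕ) → (Fin (suc n) → ℕ) → Set
SameSet p pr {n} ε a b =
  (∀ (x : Vec ℕ (suc n)) → x ∈P[ p , pr , ε , a ] → x ∈P[ p , pr , ε , b ])
  × (∀ (x : Vec ℕ (suc n)) → x ∈P[ p , pr , ε , b ] → x ∈P[ p , pr , ε , a ])

module Submission where

-- Write x_j^a for the point with index j and m_i(a,j) = a_i j^i for the i-th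
-- monomial.  The i-th numerator of x_j^a is (Σ_{h<i} ε_h a_h j^h + a_i j^i) mod p,
-- so by induction on i two points agree, x_j^a = x_k^b, exactly when all
-- monomials agree, a_i j^i ≡ b_i k^i (mod p); call this "a at j agrees with
-- b at k".  Agreement is stable under simultaneous rescaling of j and k, so if
-- k is invertible mod p every point x_m^b equals x_{j k⁻¹ m}^a and P^b ⊆ P^a.
-- Hence one agreement with j, k both nonzero mod p forces P^a = P^b.
--  (1, ⇐) c rescales a to b iff a at 1 agrees with b at c.
--  (1, ⇒) x_1^a lies in P^b, giving an agreement of a at 1 with b at some k;
--         k = 0 forces a ≡ 0, and then x_1^b ∈ P^a forces b ≡ 0, so c = 1 works.
--  (2)    x_0 is the origin for every a; a common point x_j^a = x_k^b with
--         j, k ≠ 0 would already give P^a = P^b.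

open import Defs
open import Data.Bool using (Bool; true; false; if_then_else_; T)
open import Data.Fin using (Fin; toℕ; inject₁) renaming (zero to fzero; suc to fsuc)
open import Data.Fin.Properties using (toℕ-inject₁)
open import Data.Nat
open import Data.Nat.Properties
open import Data.Nat.DivMod
open import Data.Nat.Primality using (Prime; prime⇒nonZero; prime⇒nonTrivial)
open import Data.Nat.Coprimality using (coprime-Bézout; prime⇒coprime)
open import Data.Nat.GCD using (module Bézout)
open import Data.Nat.Tactic.RingSolver using (solve-∀)
open import Data.Vec using (Vec; tabulate; sum; replicate; lookup)
open import Data.Vec.Properties using (tabulate-cong; lookup∘tabulate; tabulate∘lookup; lookup-replicate)
open import Data.Product using (∃-syntax; _×_; _,_)
open import Data.Empty using (⊥-elim)
open import Relation.Nullary using (¬_)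
open import Relation.Binary.PropositionalEquality
open ≡-Reasoning

^-distribʳ-* : ∀ x y e → (x * y) ^ e ≡ x ^ e * y ^ e
^-distribʳ-* x y zero    = refl
^-distribʳ-* x y (suc e) = begin
  x * y * (x * y) ^ e       ≡⟨ cong (x * y *_) (^-distribʳ-* x y e) ⟩
  x * y * (x ^ e * y ^ e)   ≡⟨ interchange x y (x ^ e) (y ^ e) ⟩
  x * x ^ e * (y * y ^ e)   ∎
  where
  interchange : ∀ x y u v → x * y * (u * v) ≡ x * u * (y * v)
  interchange = solve-∀

sum-zero : ∀ {k} (f : Fin k → ℕ) → (∀ h → f h ≡ 0) → sum (tabulate f) ≡ 0
sum-zero {zero}  f f≡0 = refl
sum-zero {suc k} f f≡0 =
  cong₂ _+_ (f≡0 fzero) (sum-zero (λ h → f (fsuc h)) (λ h → f≡0 (fsuc h)))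

module Congruence (m : ℕ) .{{_ : NonZero m}} where

  infix 4 _≋_
  _≋_ : ℕ → ℕ → Set
  x ≋ y = x % m ≡ y % m

  %-≋ : ∀ x → x % m ≋ x
  %-≋ x = m%n%n≡m%n x m

  ≋-+ : ∀ {x y z w} → x ≋ y → z ≋ w → x + z ≋ y + w
  ≋-+ {x} {y} {z} {w} x≋y z≋w = begin
    (x + z) % m             ≡⟨ %-distribˡ-+ x z m ⟩
    (x % m + z % m) % m     ≡⟨ cong₂ (λ u v → (u + v) % m) x≋y z≋w ⟩
    (y % m + w % m) % m     ≡⟨ %-distribˡ-+ y w m ⟨
    (y + w) % m             ∎

  ≋-* : ∀ {x y z w} → x ≋ y → z ≋ w → x * z ≋ y * w
  ≋-* {x} {y} {z} {w} x≋y z≋w = begin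
    (x * z) % m             ≡⟨ %-distribˡ-* x z m ⟩
    (x % m * (z % m)) % m   ≡⟨ cong₂ (λ u v → (u * v) % m) x≋y z≋w ⟩
    (y % m * (w % m)) % m   ≡⟨ %-distribˡ-* y w m ⟨
    (y * w) % m             ∎

  ≋-^ : ∀ {x y} e → x ≋ y → x ^ e ≋ y ^ e
  ≋-^ zero    x≋y = refl
  ≋-^ (suc e) x≋y = ≋-* x≋y (≋-^ e x≋y)

  -- Addition can be cancelled: adding r·(m-1) turns r + t into t plus a
  -- multiple of m.
  +-cancelˡ-≋ : ∀ r {t t′} → r + t ≋ r + t′ → t ≋ t′
  +-cancelˡ-≋ r {t} {t′} r+t≋r+t′ = begin
    t % m                   ≡⟨ [m+kn]%n≡m%n t r m ⟨
    (t + r * m) % m         ≡⟨ cong (_% m) (complement t) ⟩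
    (r * q + (r + t)) % m   ≡⟨ ≋-+ {r * q} {r * q} refl r+t≋r+t′ ⟩
    (r * q + (r + t′)) % m  ≡⟨ cong (_% m) (complement t′) ⟨
    (t′ + r * m) % m        ≡⟨ [m+kn]%n≡m%n t′ r m ⟩
    t′ % m                  ∎
    where
    q = pred m
    regroup : ∀ r q t → t + r * suc q ≡ r * q + (r + t)
    regroup = solve-∀
    complement : ∀ t → t + r * m ≡ r * q + (r + t)
    complement t = trans (cong (λ k → t + r * k) (sym (suc-pred m))) (regroup r q t)

  ≋-cancel-+ : ∀ {s s′ t t′} → s ≋ s′ → s + t ≋ s′ + t′ → t ≋ t′
  ≋-cancel-+ {s} {s′} {t} {t′} s≋s′ s+t≋s′+t′ =
    +-cancelˡ-≋ s (trans s+t≋s′+t′ (≋-+ {s′} {s} {t′} {t′} (sym s≋s′) refl))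

  ≋-sum : ∀ {k} (f g : Fin k → ℕ) → (∀ h → f h ≋ g h) → sum (tabulate f) ≋ sum (tabulate g)
  ≋-sum {zero}  f g f≋g = refl
  ≋-sum {suc k} f g f≋g =
    ≋-+ (f≋g fzero) (≋-sum (λ h → f (fsuc h)) (λ h → g (fsuc h)) (λ h → f≋g (fsuc h)))

module PrimeModulus (p : ℕ) (pr : Prime p) where

  instance
    p-nonZero : NonZero p
    p-nonZero = prime⇒nonZero pr

  open Congruence p public

  1<p : 1 < p
  1<p = nonTrivial⇒n>1 p {{prime⇒nonTrivial pr}}

  Invertible : ℕ → Set
  Invertible c = ∃[ u ] (u * c ≋ 1)

  -- From a Bézout identity 1 + x p = y c, or 1 + y c = x p (then y c ≡ -1 and
  -- the inverse is y (p - 1)).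
  invertible : ∀ {c} → 1 ≤ c → c < p → Invertible c
  invertible {zero}        () _
  invertible {c@(suc _)} _  c<p with coprime-Bézout (prime⇒coprime pr c<p)
  ... | Bézout.-+ x y 1+xp≡yc = y , (begin
    (y * c) % p             ≡⟨ cong (_% p) 1+xp≡yc ⟨
    (1 + x * p) % p         ≡⟨ [m+kn]%n≡m%n 1 x p ⟩
    1 % p                   ∎)
  ... | Bézout.+- x y 1+yc≡xp = y * q , +-cancelˡ-≋ q (begin
    (q + y * q * c) % p     ≡⟨ cong (_% p) q+yqc≡xqp ⟩
    (x * q * p) % p         ≡⟨ m*n%n≡0 (x * q) p ⟩
    0                       ≡⟨ n%n≡0 p ⟨
    p % p                   ≡⟨ cong (_% p) (trans (+-comm q 1) (suc-pred p)) ⟨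
    (q + 1) % p             ∎)
    where
    q = pred p
    expand : ∀ q y c → q + y * q * c ≡ (1 + y * c) * q
    expand = solve-∀
    regroup : ∀ x p q → x * p * q ≡ x * q * p
    regroup = solve-∀
    q+yqc≡xqp : q + y * q * c ≡ x * q * p
    q+yqc≡xqp = begin
      q + y * q * c         ≡⟨ expand q y c ⟩
      (1 + y * c) * q       ≡⟨ cong (_* q) 1+yc≡xp ⟩
      x * p * q             ≡⟨ regroup x p q ⟩
      x * q * p             ∎

module Points (p : ℕ) (pr : Prime p) {n : ℕ} (ε : Fin n → Bool) where

  open PrimeModulus p pr

  Coeffs : Set
  Coeffs = Fin (suc n) → ℕ

  mono : Coeffs → ℕ → Fin (suc n) → ℕ
  mono a j i = a i * j ^ suc (toℕ i)

  -- The contribution Σ_{h<i} ε_h a_h j^h of the earlier coordinates, so that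
  -- the i-th numerator  coord p pr ε a j i  is  (lower a j i + mono a j i) mod p.
  lower : Coeffs → ℕ → Fin (suc n) → ℕ
  lower a j i = sum (tabulate (λ h → if toℕ h <ᵇ toℕ i then a′ ε a h * j ^ suc (toℕ h) else 0))

  record Agree (a b : Coeffs) (j k : ℕ) : Set where
    constructor agreeing
    field congruent : ∀ i → mono a j i ≋ mono b k i
  open Agree

  Agree-sym : ∀ {a b j k} → Agree a b j k → Agree b a k j
  Agree-sym (agreeing a≋b) = agreeing (λ i → sym (a≋b i))

  mono-inject₁ : ∀ a j (h : Fin n) → mono a j (inject₁ h) ≡ a (inject₁ h) * j ^ suc (toℕ h)
  mono-inject₁ a j h = cong (λ e → a (inject₁ h) * j ^ suc e) (toℕ-inject₁ h)

  lower-cong : ∀ a b j k i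
             → (∀ (h : Fin n) → toℕ h < toℕ i → mono a j (inject₁ h) ≋ mono b k (inject₁ h))
             → lower a j i ≋ lower b k i
  lower-cong a b j k i agree-below = ≋-sum _ _ term
    where
    term : ∀ h → (if toℕ h <ᵇ toℕ i then a′ ε a h * j ^ suc (toℕ h) else 0)
               ≋ (if toℕ h <ᵇ toℕ i then a′ ε b h * k ^ suc (toℕ h) else 0)
    term h with toℕ h <ᵇ toℕ i in h<ᵇi | ε h
    ... | false | _     = refl
    ... | true  | false = refl
    ... | true  | true  = begin
      (a (inject₁ h) * j ^ suc (toℕ h)) % p   ≡⟨ cong (_% p) (mono-inject₁ a j h) ⟨
      mono a j (inject₁ h) % p               ≡⟨ agree-below h h<i ⟩
      mono b k (inject₁ h) % p               ≡⟨ cong (_% p) (mono-inject₁ b k h) ⟩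
      (b (inject₁ h) * k ^ suc (toℕ h)) % p   ∎
      where
      h<i : toℕ h < toℕ i
      h<i = <ᵇ⇒< (toℕ h) (toℕ i) (subst T (sym h<ᵇi) _)

  coord-≡ : ∀ {a b j k} → point p pr ε a j ≡ point p pr ε b k
          → ∀ i → coord p pr ε a j i ≡ coord p pr ε b k i
  coord-≡ {a} {b} {j} {k} x≡y i = begin
    coord p pr ε a j i                ≡⟨ lookup∘tabulate (coord p pr ε a j) i ⟨
    lookup (point p pr ε a j) i       ≡⟨ cong (λ v → lookup v i) x≡y ⟩
    lookup (point p pr ε b k) i       ≡⟨ lookup∘tabulate (coord p pr ε b k) i ⟩
    coord p pr ε b k i                ∎

  -- Equal points have congruent monomials: peel off the coordinates in order,
  -- cancelling the (already congruent) lower parts.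
  point-≡⇒Agree : ∀ {a b j k} → point p pr ε a j ≡ point p pr ε b k → Agree a b j k
  point-≡⇒Agree {a} {b} {j} {k} x≡y = agreeing λ i → below (suc (toℕ i)) i (n<1+n (toℕ i))
    where
    below : ∀ bound i → toℕ i < bound → mono a j i ≋ mono b k i
    below zero        i ()
    below (suc bound) i i<1+bound =
      ≋-cancel-+ (lower-cong a b j k i agree-below) (coord-≡ {a} {b} {j} {k} x≡y i)
      where
      agree-below : ∀ (h : Fin n) → toℕ h < toℕ i → mono a j (inject₁ h) ≋ mono b k (inject₁ h)
      agree-below h h<i = below bound (inject₁ h)
        (subst (_< bound) (sym (toℕ-inject₁ h)) (<-≤-trans h<i (s≤s⁻¹ i<1+bound)))

  Agree⇒point-≡ : ∀ {a b j k} → Agree a b j k → point p pr ε a j ≡ point p pr ε b k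
  Agree⇒point-≡ {a} {b} {j} {k} (agreeing a≋b) = tabulate-cong λ i →
    ≋-+ {lower a j i} {lower b k i} (lower-cong a b j k i (λ h _ → a≋b (inject₁ h))) (a≋b i)

  mono-scale : ∀ a j s i → mono a (j * s) i ≡ mono a j i * s ^ suc (toℕ i)
  mono-scale a j s i = begin
    a i * (j * s) ^ e       ≡⟨ cong (a i *_) (^-distribʳ-* j s e) ⟩
    a i * (j ^ e * s ^ e)   ≡⟨ *-assoc (a i) (j ^ e) (s ^ e) ⟨
    a i * j ^ e * s ^ e     ∎
    where e = suc (toℕ i)

  mono-cong : ∀ a {j j′} i → j ≋ j′ → mono a j i ≋ mono a j′ i
  mono-cong a i j≋j′ = ≋-* {a i} {a i} refl (≋-^ (suc (toℕ i)) j≋j′)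

  Agree-rescale : ∀ {a b j k u} → Agree a b j k → u * k ≋ 1 → ∀ m → Agree a b (j * (u * m)) m
  Agree-rescale {a} {b} {j} {k} {u} (agreeing a≋b) uk≋1 m = agreeing λ i → rescaled i
    where
    s = u * m
    regroup : ∀ k u m → k * (u * m) ≡ u * k * m
    regroup = solve-∀
    ks≋m : k * s ≋ m
    ks≋m = begin
      (k * (u * m)) % p         ≡⟨ cong (_% p) (regroup k u m) ⟩
      (u * k * m) % p           ≡⟨ ≋-* {u * k} {1} {m} uk≋1 refl ⟩
      (1 * m) % p               ≡⟨ cong (_% p) (*-identityˡ m) ⟩
      m % p                     ∎
    rescaled : ∀ i → mono a (j * s) i ≋ mono b m i
    rescaled i = begin
      mono a (j * s) i % p      ≡⟨ cong (_% p) (mono-scale a j s i) ⟩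
      (mono a j i * s ^ e) % p  ≡⟨ ≋-* {mono a j i} {mono b k i} {s ^ e} (a≋b i) refl ⟩
      (mono b k i * s ^ e) % p  ≡⟨ cong (_% p) (mono-scale b k s i) ⟨
      mono b (k * s) i % p      ≡⟨ mono-cong b i ks≋m ⟩
      mono b m i % p            ∎
      where e = suc (toℕ i)

  -- An agreement with an invertible index on the right gives P^b ⊆ P^a:
  -- the point x_m^b is x_{j u m mod p}^a.
  Agree⇒⊆ : ∀ {a b j k} → Agree a b j k → Invertible k
          → ∀ x → x ∈P[ p , pr , ε , b ] → x ∈P[ p , pr , ε , a ]
  Agree⇒⊆ {a} {b} {j} {k} agree (u , uk≋1) x (m , m<p , x≡x_m) =
    j′ , m%n<n (j * (u * m)) p , trans x≡x_m (sym (Agree⇒point-≡ agree′))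
    where
    j′ = (j * (u * m)) % p
    agree′ : Agree a b j′ m
    agree′ = agreeing λ i →
      trans (mono-cong a i (%-≋ (j * (u * m)))) (congruent (Agree-rescale {u = u} agree uk≋1 m) i)

  Agree⇒SameSet : ∀ {a b j k} → Agree a b j k → Invertible j → Invertible k → SameSet p pr ε a b
  Agree⇒SameSet agree j-inv k-inv = Agree⇒⊆ (Agree-sym agree) j-inv , Agree⇒⊆ agree k-inv

  -- b is obtained from a by the substitution j ↦ c j:  b_i c^i ≡ a_i (mod p).
  ScaledBy : Coeffs → Coeffs → ℕ → Set
  ScaledBy a b c = ∀ i → mono b c i ≋ a i

  mono-at-1 : ∀ a i → mono a 1 i ≡ a i
  mono-at-1 a i = trans (cong (a i *_) (^-zeroˡ (suc (toℕ i)))) (*-identityʳ (a i))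

  ScaledBy⇒Agree : ∀ {a b c} → ScaledBy a b c → Agree a b 1 c
  ScaledBy⇒Agree {a} scaled = agreeing λ i → trans (cong (_% p) (mono-at-1 a i)) (sym (scaled i))

  Agree⇒ScaledBy : ∀ {a b c} → Agree a b 1 c → ScaledBy a b c
  Agree⇒ScaledBy {a} (agreeing a≋b) i = trans (sym (a≋b i)) (cong (_% p) (mono-at-1 a i))

  ScaledBy⇒SameSet : ∀ {a b} → ∃[ c ] (1 ≤ c × c < p × ScaledBy a b c) → SameSet p pr ε a b
  ScaledBy⇒SameSet {a} {b} (c , 1≤c , c<p , scaled) =
    Agree⇒SameSet (ScaledBy⇒Agree {a} {b} {c} scaled) (invertible ≤-refl 1<p) (invertible 1≤c c<p)

  -- Part (1), ⇒.  Compare x_1^a with its partner x_k^b.  If k = 0 then a ≡ 0, and comparing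
  -- x_1^b with its partner in P^a shows b ≡ 0 as well, so c = 1 works.
  SameSet⇒ScaledBy : ∀ {a b} → SameSet p pr ε a b → ∃[ c ] (1 ≤ c × c < p × ScaledBy a b c)
  SameSet⇒ScaledBy {a} {b} (a⊆b , b⊆a) with a⊆b (point p pr ε a 1) (1 , 1<p , refl)
  ... | suc k , k<p , x₁≡y = suc k , s≤s z≤n , k<p , Agree⇒ScaledBy {a} {b} (point-≡⇒Agree {a} {b} x₁≡y)
  ... | zero , _ , x₁≡y₀ with b⊆a (point p pr ε b 1) (1 , 1<p , refl)
  ...   | j , _ , y₁≡x = 1 , ≤-refl , 1<p , b≋a
    where
    a≋0 : ∀ i → a i ≋ 0
    a≋0 i = begin
      a i % p                   ≡⟨ cong (_% p) (mono-at-1 a i) ⟨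
      mono a 1 i % p            ≡⟨ congruent (point-≡⇒Agree {a} {b} {1} {0} x₁≡y₀) i ⟩
      (b i * 0) % p             ≡⟨ cong (_% p) (*-zeroʳ (b i)) ⟩
      0 % p                     ∎
    b≋a : ScaledBy a b 1
    b≋a i = begin
      mono b 1 i % p            ≡⟨ congruent (point-≡⇒Agree {b} {a} {1} {j} y₁≡x) i ⟩
      mono a j i % p            ≡⟨ ≋-* {a i} {0} {j ^ suc (toℕ i)} (a≋0 i) refl ⟩
      0 % p                     ≡⟨ a≋0 i ⟨
      a i % p                   ∎

  origin : Vec ℕ (suc n)
  origin = replicate (suc n) 0

  point-at-0 : ∀ a → point p pr ε a 0 ≡ origin
  point-at-0 a = begin
    tabulate (coord p pr ε a 0)   ≡⟨ tabulate-cong coord-at-0 ⟩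
    tabulate (lookup origin)      ≡⟨ tabulate∘lookup origin ⟩
    origin                        ∎
    where
    lower-term-0 : ∀ i h → (if toℕ h <ᵇ toℕ i then a′ ε a h * 0 ^ suc (toℕ h) else 0) ≡ 0
    lower-term-0 i h with toℕ h <ᵇ toℕ i
    ... | true  = *-zeroʳ (a′ ε a h)
    ... | false = refl
    coord-at-0 : ∀ i → coord p pr ε a 0 i ≡ lookup origin i
    coord-at-0 i = begin
      (lower a 0 i + mono a 0 i) % p  ≡⟨ cong₂ (λ s t → (s + t) % p) (sum-zero _ (lower-term-0 i)) (*-zeroʳ (a i)) ⟩
      0 % p                           ≡⟨ m<n⇒m%n≡m (>-nonZero⁻¹ p) ⟩
      0                               ≡⟨ lookup-replicate i 0 ⟨
      lookup origin i                 ∎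

  origin∈P : ∀ a → origin ∈P[ p , pr , ε , a ]
  origin∈P a = 0 , >-nonZero⁻¹ p , sym (point-at-0 a)

  origin∈both : ∀ {a b} x → x ≡ origin → x ∈P[ p , pr , ε , a ] × x ∈P[ p , pr , ε , b ]
  origin∈both {a} {b} _ refl = origin∈P a , origin∈P b

  -- Part (2).  A common point other than x_0 would be an agreement between invertible
  -- indices, forcing the two sets to coincide.
  common-point⇒origin : ∀ {a b} → ¬ SameSet p pr ε a b
                      → ∀ x → x ∈P[ p , pr , ε , a ] × x ∈P[ p , pr , ε , b ] → x ≡ origin
  common-point⇒origin {a} {b} _ x ((zero , _ , x≡x₀) , _) = trans x≡x₀ (point-at-0 a)
  common-point⇒origin {a} {b} _ x (_ , (zero , _ , x≡y₀)) = trans x≡y₀ (point-at-0 b)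
  common-point⇒origin {a} {b} distinct x ((suc j , j<p , x≡xⱼ) , (suc k , k<p , x≡yₖ)) =
    ⊥-elim (distinct (Agree⇒SameSet (point-≡⇒Agree {a} {b} (trans (sym x≡xⱼ) x≡yₖ))
                                    (invertible (s≤s z≤n) j<p) (invertible (s≤s z≤n) k<p)))

theorem2p4 : (p : ℕ) (pr : Prime p) (n : ℕ) (ε : Fin n → Bool)
    (a b : Fin (suc n) → ℕ) → (∀ i → a i < p) → (∀ i → b i < p)
    → ((SameSet p pr ε a b
          → ∃[ c ] (1 ≤ c × c < p
              × (∀ (i : Fin (suc n)) → modP p pr (b i * c ^ suc (toℕ i)) ≡ modP p pr (a i))))
       × (∃[ c ] (1 ≤ c × c < p
              × (∀ (i : Fin (suc n)) → modP p pr (b i * c ^ suc (toℕ i)) ≡ modP p pr (a i)))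
          → SameSet p pr ε a b))
    × (¬ SameSet p pr ε a b
       → ∀ (x : Vec ℕ (suc n))
         → ((x ∈P[ p , pr , ε , a ] × x ∈P[ p , pr , ε , b ]) → x ≡ replicate (suc n) 0)
           × (x ≡ replicate (suc n) 0 → x ∈P[ p , pr , ε , a ] × x ∈P[ p , pr , ε , b ]))
theorem2p4 p pr n ε a b _ _ =
  (SameSet⇒ScaledBy {a} {b} , ScaledBy⇒SameSet {a} {b}) ,
  λ distinct x → common-point⇒origin {a} {b} distinct x , origin∈both {a} {b} x
  where open Points p pr ε
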